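{- The permutation matrices $I_2=\begin{bmatrix}1&0\\0&1\end{bmatrix}$ and $J_2=\begin{bmatrix}0&1\\1&0\end{bmatrix}$ are forest-shape-Wilf equivalent; that is, for every forest-Young diagram $Y$, the number of transversals of $Y$ avoiding $I_2$ equals the number of transversals of $Y$ avoiding $J_2$.
   Context: Let $F$ be an unlabeled rooted forest. A forest-Young diagram on $F$ is a finite set $Y$ of pairs $(r,v)$ with $r$ a positive integer and $v$ a vertex of $F$ such that: $(1,v)\in Y$ for all $v$; $(r,v)\in Y$ implies $(r',v)\in Y$ for $1\le r'\le r$; $(r,v)\in Y$ implies $(r,v')\in Y$ for every descendant $v'$ of $v$. The $r$th row is $\{(r,v)\in Y\}$ and the column of $v$ is $\{(r,v)\in Y\}$. A transversal of $Y$ is a labeling of the elements of $Y$ by $0$'s and $1$'s with exactly one $1$ in each nonempty row and in each column. A transversal contains a $k\times k$ permutation matrix $M$ if there exist vertices $v_1,\dots,v_k$ with $v_i$ a strict ancestor of $v_j$ for $i<j$, and row indices $r_1<\cdots<r_k$, such that for all $1\le i,j\le k$, $(r_i,v_j)\in Y$ and the label of $(r_i,v_j)$ equals the $(i,j)$ entry of $M$; otherwise it avoids $M$. -}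

module Defs where

open import Data.Nat using (ℕ; zero; suc; _≤_; _<_)
open import Data.Fin using (Fin; toℕ; _≟_)
open import Data.Bool using (Bool; true; false; not)
open import Data.Maybe using (Maybe; just; nothing)
open import Data.Product using (Σ; _×_; ∃)
open import Data.Vec using (Vec; []; _∷_; lookup)
open import Data.Vec.Relation.Unary.All using (All; []; _∷_)
import Data.Fin as Fin
open import Data.Refinement using (Refinement)
open import Relation.Nullary using (¬_)
open import Relation.Nullary.Decidable using (⌊_⌋)
open import Relation.Binary.PropositionalEquality using (_≡_)

-- Acyclicity is ensured by requiring that a parent
-- has a smaller index than its child; every finite rooted forest
-- (unlabeled) admits such a vertex labeling.
record Forest (n : ℕ) : Set where
  field
    parent  : Fin n → Maybe (Fin n)
    parent< : ∀ {u v} → parent v ≡ just u → toℕ u < toℕ v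
open Forest public

data Anc {n : ℕ} (F : Forest n) (u : Fin n) : Fin n → Set where
  here  : ∀ {v} → parent F v ≡ just u → Anc F u v
  there : ∀ {v w} → parent F v ≡ just w → Anc F u w → Anc F u v

-- Y = {(r,v) | 1 ≤ r ≤ height v}; this is
-- exactly the data of a finite set Y closed downward in each column
-- (and containing (1,v) for all v), and the descendant condition says
-- that heights weakly increase from a vertex to its descendants.
record ForestYoung {n : ℕ} (F : Forest n) : Set where
  field
    heights  : Vec ℕ n
    positive : ∀ v → 1 ≤ lookup heights v
    closed   : ∀ {u v} → Anc F u v → lookup heights u ≤ lookup heights v
open ForestYoung public

module _ {n : ℕ} {F : Forest n} (Y : ForestYoung F) where

  height : Fin n → ℕ
  height v = lookup (heights Y) v

  InY : ℕ → Fin n → Set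
  InY r v = 1 ≤ r × r ≤ height v

  -- A labeling of the elements of Y by 0/1 (false/true): for each vertex
  -- v, a vector of the labels of (1,v), …, (height v, v).
  Labeling : Set
  Labeling = All (Vec Bool) (heights Y)

-- label of the r-th entry (rows 1-based) of a column vector; the value
-- outside 1 ≤ r ≤ length is an irrelevant default (only used for (r,v) ∈ Y).
colAt : ∀ {k} → Vec Bool k → ℕ → Bool
colAt []       r             = false
colAt (b ∷ bs) zero          = false
colAt (b ∷ bs) (suc zero)    = b
colAt (b ∷ bs) (suc (suc r)) = colAt bs (suc r)

column : ∀ {n} {hs : Vec ℕ n} → All (Vec Bool) hs → (v : Fin n) → Vec Bool (lookup hs v)
column (c ∷ cs) Fin.zero    = c
column (c ∷ cs) (Fin.suc v) = column cs v

ExactlyOne : {A : Set} → (A → Set) → Set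
ExactlyOne {A} P = Σ A λ x → P x × (∀ y → P y → y ≡ x)

module _ {n : ℕ} {F : Forest n} (Y : ForestYoung F) where

  label : Labeling Y → ℕ → Fin n → Bool
  label L r v = colAt (column L v) r

  Transversal : Labeling Y → Set
  Transversal L =
    (∀ v → ExactlyOne (λ r → InY Y r v × label L r v ≡ true)) ×
    (∀ r → (∃ λ v → InY Y r v) →
           ExactlyOne (λ v → InY Y r v × label L r v ≡ true))

  Contains : ∀ {k} → (Fin k → Fin k → Bool) → Labeling Y → Set
  Contains {k} M L =
    Σ (Fin k → Fin n) λ vs → Σ (Fin k → ℕ) λ rs →
      (∀ i j → toℕ i < toℕ j → Anc F (vs i) (vs j)) ×
      (∀ i j → toℕ i < toℕ j → rs i < rs j) ×
      (∀ i j → InY Y (rs i) (vs j) × label L (rs i) (vs j) ≡ M i j)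

  Avoids : ∀ {k} → (Fin k → Fin k → Bool) → Labeling Y → Set
  Avoids M L = ¬ Contains M L

  AvoidingTransversals : ∀ {k} → (Fin k → Fin k → Bool) → Set
  AvoidingTransversals M =
    Refinement (Labeling Y) (λ L → Transversal L × Avoids M L)

I₂ : Fin 2 → Fin 2 → Bool
I₂ i j = ⌊ i ≟ j ⌋

J₂ : Fin 2 → Fin 2 → Bool
J₂ i j = not ⌊ i ≟ j ⌋

{-# OPTIONS --safe #-}

-- A transversal is recorded by the row s v of the 1 in each column v.  It avoids
-- J₂ iff rows strictly increase from every vertex u to its descendants, and it
-- avoids I₂ iff every descendant of u has its row below s u or above the top of
-- column u.  Treat the vertices one at a time, parents before children; at k,
-- cyclically shift the rows of k's subtree that lie within column k, each to the
-- next smaller one and the smallest to the largest.  Before the shift s k is the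
-- smallest of these rows, afterwards it is the largest, so k trades the J₂-condition
-- for the I₂-condition while every other vertex keeps its condition.  The shift
-- preserves transversals and is undone by the opposite shift, so applying it at
-- every vertex is a bijection between the two kinds of transversals.
module Submission where

open import Defs
open import Level using (0ℓ)
open import Data.Bool.Base using (Bool; true; false; if_then_else_)
open import Data.Bool.Properties using () renaming (_≟_ to _≟ᵇ_)
open import Data.Fin.Base using (Fin; toℕ; fromℕ<) renaming (_<_ to _<ᶠ_)
import Data.Fin.Base as Fin
open import Data.Fin.Induction using (<-wellFounded)
open import Data.Fin.Patterns using (0F; 1F)
open import Data.Fin.Properties using (any?; all?; toℕ-injective; toℕ-fromℕ<; toℕ<n) renaming (_≟_ to _≟ᶠ_)
open import Data.Irrelevant using ([_])
open import Data.Maybe.Base using (just; nothing)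
open import Data.Maybe.Properties using (just-injective)
open import Data.Nat.Base using (ℕ; zero; suc; _≤_; _<_; z≤n; s≤s)
open import Data.Nat.Properties
open import Data.Product.Base using (∃; _×_; _,_; proj₁; proj₂; map₂)
open import Data.Refinement using (Refinement; _,_; value-injective)
import Data.Refinement as Refinement
open import Data.Sum.Base using (_⊎_; inj₁; inj₂)
open import Data.Vec.Base using (Vec; []; _∷_; lookup; tabulate)
open import Data.Vec.Properties using (lookup∘tabulate; tabulate∘lookup; tabulate-cong) renaming (≡-dec to ≡-decᵛ)
open import Data.Vec.Relation.Unary.All using (All; []; _∷_)
open import Data.Vec.Relation.Unary.All.Properties using (lookup⁻)
open import Function.Base using (_∘_)
open import Function.Bundles using (_↔_; _⇔_; mk↔ₛ′; mk⇔; Equivalence)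
open import Function.Related.Propositional using (bijection; module EquationalReasoning)
open import Induction.WellFounded using (Acc; acc)
open import Relation.Binary.Definitions using (Decidable; tri<; tri≈; tri>)
open import Relation.Binary.PropositionalEquality
  using (_≡_; _≢_; refl; sym; trans; cong; cong₂; subst; subst₂; module ≡-Reasoning)
open import Relation.Binary.Construct.Closure.Reflexive using (ReflClosure; refl; [_])
import Relation.Binary.Construct.Closure.Reflexive.Properties as ReflClosure
open import Relation.Nullary using (¬_; Dec; yes; no; contradiction)
open import Relation.Nullary.Decidable using (_×-dec_; ⌊_⌋; toSum; recompute)
import Relation.Nullary.Decidable as Dec
import Relation.Unary as U

module Ancestry {n : ℕ} (F : Forest n) where

  _≼_ : Fin n → Fin n → Set
  _≼_ = ReflClosure (Anc F)

  anc⇒< : ∀ {u v} → Anc F u v → toℕ u < toℕ v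
  anc⇒< (here p)    = parent< F p
  anc⇒< (there p a) = <-trans (anc⇒< a) (parent< F p)

  anc-irrefl : ∀ {u} → ¬ Anc F u u
  anc-irrefl a = <-irrefl refl (anc⇒< a)

  anc-trans : ∀ {u v w} → Anc F u v → Anc F v w → Anc F u w
  anc-trans a (here p)    = there p a
  anc-trans a (there p b) = there p (anc-trans a b)

  anc-≼-trans : ∀ {u v w} → Anc F u v → v ≼ w → Anc F u w
  anc-≼-trans a refl  = a
  anc-≼-trans a [ b ] = anc-trans a b

  ≼⇒≤ : ∀ {u v} → u ≼ v → toℕ u ≤ toℕ v
  ≼⇒≤ refl  = ≤-refl
  ≼⇒≤ [ a ] = <⇒≤ (anc⇒< a)

  private
    parent-unique : ∀ {v a b} → parent F v ≡ just a → parent F v ≡ just b → a ≡ b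
    parent-unique p q = just-injective (trans (sym p) q)

  ancestors-comparable : ∀ {u v w} → Anc F u w → Anc F v w → u ≼ v ⊎ v ≼ u
  ancestors-comparable (here p) (here q) with parent-unique p q
  ... | refl = inj₁ refl
  ancestors-comparable (here p) (there q b) with parent-unique p q
  ... | refl = inj₂ [ b ]
  ancestors-comparable (there p a) (here q) with parent-unique p q
  ... | refl = inj₁ [ a ]
  ancestors-comparable (there p a) (there q b) with parent-unique p q
  ... | refl = ancestors-comparable a b

  anc-into-subtree : ∀ {k u v} → ¬ k ≼ u → Anc F u v → k ≼ v → Anc F u k
  anc-into-subtree k⋠u a refl = a
  anc-into-subtree k⋠u a [ b ] with ancestors-comparable a b
  ... | inj₁ refl  = contradiction refl k⋠u
  ... | inj₁ [ c ] = c
  ... | inj₂ c     = contradiction c k⋠u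

  anc? : Decidable (Anc F)
  anc? u v = search v (<-wellFounded v)
    where
      root-has-no-ancestor : ∀ {v} → parent F v ≡ nothing → ¬ Anc F u v
      root-has-no-ancestor eq (here p)    with () ← trans (sym eq) p
      root-has-no-ancestor eq (there p _) with () ← trans (sym eq) p

      search : ∀ v → Acc _<ᶠ_ v → Dec (Anc F u v)
      search v (acc rec) with parent F v in eq
      ... | nothing = no (root-has-no-ancestor eq)
      ... | just w with w ≟ᶠ u
      ...   | yes refl = yes (here eq)
      ...   | no w≢u   = Dec.map′ (there eq) ancestor-of-parent (search w (rec (parent< F eq)))
        where
          ancestor-of-parent : Anc F u v → Anc F u w
          ancestor-of-parent (here p)    = contradiction (parent-unique eq p) w≢u
          ancestor-of-parent (there p a) with refl ← parent-unique eq p = a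

  _≼?_ : Decidable _≼_
  _≼?_ = ReflClosure.dec _≟ᶠ_ anc?

module BoundedSearch {P : U.Pred ℕ 0ℓ} (P? : U.Decidable P) where

  greatestBelow : ℕ → ℕ → ℕ
  greatestBelow zero    d = d
  greatestBelow (suc b) d with P? b
  ... | yes _ = b
  ... | no  _ = greatestBelow b d

  leastBelow : ℕ → ℕ → ℕ
  leastBelow zero    d = d
  leastBelow (suc b) d with P? b
  ... | yes _ = leastBelow b b
  ... | no  _ = leastBelow b d

  NoneBelow : ℕ → Set
  NoneBelow b = ∀ {z} → z < b → ¬ P z

  greatestBelow-none : ∀ {b} d → NoneBelow b → greatestBelow b d ≡ d
  greatestBelow-none {zero}  d none = refl
  greatestBelow-none {suc b} d none with P? b
  ... | yes p = contradiction p (none ≤-refl)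
  ... | no  _ = greatestBelow-none d (λ z<b → none (m≤n⇒m≤1+n z<b))

  greatestBelow-member : ∀ {b y} d → y < b → P y → greatestBelow b d < b × P (greatestBelow b d)
  greatestBelow-member {suc b} d y<1+b py with P? b
  ... | yes pb = ≤-refl , pb
  ... | no ¬pb with m≤n⇒m<n∨m≡n (≤-pred y<1+b)
  ...   | inj₂ refl = contradiction py ¬pb
  ...   | inj₁ y<b  = let g<b , pg = greatestBelow-member d y<b py in m≤n⇒m≤1+n g<b , pg

  greatestBelow-upper : ∀ {b z} d → z < b → P z → z ≤ greatestBelow b d
  greatestBelow-upper {suc b} d z<1+b pz with P? b
  ... | yes _  = ≤-pred z<1+b
  ... | no ¬pb with m≤n⇒m<n∨m≡n (≤-pred z<1+b)
  ...   | inj₂ refl = contradiction pz ¬pb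
  ...   | inj₁ z<b  = greatestBelow-upper d z<b pz

  leastBelow-default-or-member : ∀ b d → leastBelow b d ≡ d ⊎ (leastBelow b d < b × P (leastBelow b d))
  leastBelow-default-or-member zero    d = inj₁ refl
  leastBelow-default-or-member (suc b) d with P? b
  ... | yes pb with leastBelow-default-or-member b b
  ...   | inj₁ l≡b          rewrite l≡b = inj₂ (≤-refl , pb)
  ...   | inj₂ (l<b , pl)   = inj₂ (m≤n⇒m≤1+n l<b , pl)
  leastBelow-default-or-member (suc b) d | no _ with leastBelow-default-or-member b d
  ...   | inj₁ l≡d          = inj₁ l≡d
  ...   | inj₂ (l<b , pl)   = inj₂ (m≤n⇒m≤1+n l<b , pl)

  leastBelow-none : ∀ {b} d → NoneBelow b → leastBelow b d ≡ d
  leastBelow-none {zero}  d none = refl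
  leastBelow-none {suc b} d none with P? b
  ... | yes p = contradiction p (none ≤-refl)
  ... | no  _ = leastBelow-none d (λ z<b → none (m≤n⇒m≤1+n z<b))

  leastBelow-member : ∀ {b y} d → y < b → P y → leastBelow b d < b × P (leastBelow b d)
  leastBelow-member {suc b} d y<1+b py with P? b
  ... | yes pb with leastBelow-default-or-member b b
  ...   | inj₁ l≡b        rewrite l≡b = ≤-refl , pb
  ...   | inj₂ (l<b , pl) = m≤n⇒m≤1+n l<b , pl
  leastBelow-member {suc b} d y<1+b py | no ¬pb with m≤n⇒m<n∨m≡n (≤-pred y<1+b)
  ...   | inj₂ refl = contradiction py ¬pb
  ...   | inj₁ y<b  = let l<b , pl = leastBelow-member d y<b py in m≤n⇒m≤1+n l<b , pl

  leastBelow-lower : ∀ {b z} d → z < b → P z → leastBelow b d ≤ z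
  leastBelow-lower {suc b} d z<1+b pz with P? b | m≤n⇒m<n∨m≡n (≤-pred z<1+b)
  ... | yes _  | inj₁ z<b  = leastBelow-lower b z<b pz
  ... | no _   | inj₁ z<b  = leastBelow-lower d z<b pz
  ... | no ¬pb | inj₂ refl = contradiction pz ¬pb
  ... | yes _  | inj₂ refl with leastBelow-default-or-member b b
  ...   | inj₁ l≡b       = ≤-reflexive l≡b
  ...   | inj₂ (l<b , _) = <⇒≤ l<b

  leastBelow-≡ : ∀ {b y} d → y < b → P y → NoneBelow y → leastBelow b d ≡ y
  leastBelow-≡ d y<b py none =
    let l<b , pl = leastBelow-member d y<b py
    in ≤-antisym (leastBelow-lower d y<b py) (≮⇒≥ λ l<y → none l<y pl)

  greatestBelow-≡ : ∀ {b y} d → y < b → P y → (∀ {z} → y < z → z < b → ¬ P z) →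
                    greatestBelow b d ≡ y
  greatestBelow-≡ d y<b py none =
    let g<b , pg = greatestBelow-member d y<b py
    in ≤-antisym (≮⇒≥ λ y<g → none y<g g<b pg) (greatestBelow-upper d y<b py)

module Cyclic {P : U.Pred ℕ 0ℓ} (P? : U.Decidable P) (h : ℕ) where
  open BoundedSearch

  Above : ℕ → U.Pred ℕ 0ℓ
  Above x y = x < y × P y

  above? : ∀ x → U.Decidable (Above x)
  above? x y = x <? y ×-dec P? y

  maxOr : ℕ → ℕ
  maxOr = greatestBelow P? (suc h)

  minOr : ℕ → ℕ
  minOr = leastBelow P? (suc h)

  -- On the members of P (all at most h), prevCyclic moves each to the next smaller
  -- member and the least one to the greatest; nextCyclic is the opposite shift.
  prevCyclic : ℕ → ℕ
  prevCyclic x with P? x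
  ... | yes _ = greatestBelow P? x (maxOr x)
  ... | no  _ = x

  nextCyclic : ℕ → ℕ
  nextCyclic x with P? x
  ... | yes _ = leastBelow (above? x) (suc h) (minOr x)
  ... | no  _ = x

  prevCyclic-fixes : ∀ {x} → ¬ P x → prevCyclic x ≡ x
  prevCyclic-fixes {x} ¬px with P? x
  ... | yes px = contradiction px ¬px
  ... | no  _  = refl

  nextCyclic-fixes : ∀ {x} → ¬ P x → nextCyclic x ≡ x
  nextCyclic-fixes {x} ¬px with P? x
  ... | yes px = contradiction px ¬px
  ... | no  _  = refl

  prevCyclic-member : ∀ {x} → P x → prevCyclic x ≡ greatestBelow P? x (maxOr x)
  prevCyclic-member {x} px with P? x
  ... | yes _   = refl
  ... | no  ¬px = contradiction px ¬px

  nextCyclic-member : ∀ {x} → P x → nextCyclic x ≡ leastBelow (above? x) (suc h) (minOr x)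
  nextCyclic-member {x} px with P? x
  ... | yes _   = refl
  ... | no  ¬px = contradiction px ¬px

  module _ (bounded : ∀ {y} → P y → y ≤ h) where

    private
      not-above-h : ∀ {y} → h < y → ¬ P y
      not-above-h h<y py = <⇒≱ h<y (bounded py)

      below-top : ∀ {y} → P y → y < suc h
      below-top py = s≤s (bounded py)

      noneBelow : ∀ {Q : U.Pred ℕ 0ℓ} {b} → ¬ (∃ λ z → z < b × Q z) → ∀ {z} → z < b → ¬ Q z
      noneBelow ¬∃ z<b qz = ¬∃ (_ , z<b , qz)

    prevCyclic-closed : ∀ {x} → P x → P (prevCyclic x)
    prevCyclic-closed {x} px rewrite prevCyclic-member px with anyUpTo? P? x
    ... | yes (_ , y<x , py) = proj₂ (greatestBelow-member P? _ y<x py)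
    ... | no ¬∃ rewrite greatestBelow-none P? (maxOr x) (noneBelow ¬∃) =
      proj₂ (greatestBelow-member P? x (below-top px) px)

    nextCyclic-closed : ∀ {x} → P x → P (nextCyclic x)
    nextCyclic-closed {x} px rewrite nextCyclic-member px with anyUpTo? (above? x) (suc h)
    ... | yes (_ , y<b , above) = proj₂ (proj₂ (leastBelow-member (above? x) _ y<b above))
    ... | no ¬∃ rewrite leastBelow-none (above? x) (minOr x) (noneBelow ¬∃) =
      proj₂ (leastBelow-member P? x (below-top px) px)

    nextCyclic-prevCyclic : ∀ x → nextCyclic (prevCyclic x) ≡ x
    -- casing on toSum (P? x) rather than P? x keeps the goal from being with-abstracted
    nextCyclic-prevCyclic x with toSum (P? x)
    ... | inj₂ ¬px = trans (cong nextCyclic (prevCyclic-fixes ¬px)) (nextCyclic-fixes ¬px)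
    ... | inj₁ px with anyUpTo? P? x
    ...   | yes (_ , y<x , py) = begin
      nextCyclic (prevCyclic x)                      ≡⟨ cong nextCyclic (prevCyclic-member px) ⟩
      nextCyclic g                                   ≡⟨ nextCyclic-member pg ⟩
      leastBelow (above? g) (suc h) (minOr g)        ≡⟨ leastBelow-≡ (above? g) _ (below-top px) (g<x , px) gap ⟩
      x                                              ∎
      where
        open ≡-Reasoning
        g : ℕ
        g = greatestBelow P? x (maxOr x)
        g<x : g < x
        g<x = proj₁ (greatestBelow-member P? _ y<x py)
        pg : P g
        pg = proj₂ (greatestBelow-member P? _ y<x py)
        gap : ∀ {z} → z < x → ¬ Above g z
        gap z<x (g<z , pz) = <⇒≱ g<z (greatestBelow-upper P? _ z<x pz)
    ...   | no ¬∃ = begin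
      nextCyclic (prevCyclic x)                      ≡⟨ cong nextCyclic (prevCyclic-member px) ⟩
      nextCyclic (greatestBelow P? x top)
        ≡⟨ cong nextCyclic (greatestBelow-none P? top (noneBelow ¬∃)) ⟩
      nextCyclic top                                 ≡⟨ nextCyclic-member ptop ⟩
      leastBelow (above? top) (suc h) (minOr top)    ≡⟨ leastBelow-none (above? top) _ nothing-above ⟩
      leastBelow P? (suc h) top                      ≡⟨ leastBelow-≡ P? top (below-top px) px (noneBelow ¬∃) ⟩
      x                                              ∎
      where
        open ≡-Reasoning
        top : ℕ
        top = maxOr x
        ptop : P top
        ptop = proj₂ (greatestBelow-member P? x (below-top px) px)
        nothing-above : NoneBelow (above? top) (suc h)
        nothing-above z<b (top<z , pz) = <⇒≱ top<z (greatestBelow-upper P? x z<b pz)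

    prevCyclic-nextCyclic : ∀ x → prevCyclic (nextCyclic x) ≡ x
    prevCyclic-nextCyclic x with toSum (P? x)
    ... | inj₂ ¬px = trans (cong prevCyclic (nextCyclic-fixes ¬px)) (prevCyclic-fixes ¬px)
    ... | inj₁ px with anyUpTo? (above? x) (suc h)
    ...   | yes (_ , y<b , above) = begin
      prevCyclic (nextCyclic x)                      ≡⟨ cong prevCyclic (nextCyclic-member px) ⟩
      prevCyclic l                                   ≡⟨ prevCyclic-member pl ⟩
      greatestBelow P? l (maxOr l)                   ≡⟨ greatestBelow-≡ P? _ x<l px gap ⟩
      x                                              ∎
      where
        open ≡-Reasoning
        l : ℕ
        l = leastBelow (above? x) (suc h) (minOr x)
        x<l : x < l
        x<l = proj₁ (proj₂ (leastBelow-member (above? x) _ y<b above))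
        pl : P l
        pl = proj₂ (proj₂ (leastBelow-member (above? x) _ y<b above))
        gap : ∀ {z} → x < z → z < l → ¬ P z
        gap x<z z<l pz = <⇒≱ z<l (leastBelow-lower (above? x) _ (below-top pz) (x<z , pz))
    ...   | no ¬∃ = begin
      prevCyclic (nextCyclic x)                      ≡⟨ cong prevCyclic (nextCyclic-member px) ⟩
      prevCyclic (leastBelow (above? x) (suc h) bot)
        ≡⟨ cong prevCyclic (leastBelow-none (above? x) bot (noneBelow ¬∃)) ⟩
      prevCyclic bot                                 ≡⟨ prevCyclic-member pbot ⟩
      greatestBelow P? bot (maxOr bot)               ≡⟨ greatestBelow-none P? _ nothing-below ⟩
      greatestBelow P? (suc h) bot                   ≡⟨ greatestBelow-≡ P? bot (below-top px) px gap ⟩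
      x                                              ∎
      where
        open ≡-Reasoning
        bot : ℕ
        bot = minOr x
        pbot : P bot
        pbot = proj₂ (leastBelow-member P? x (below-top px) px)
        nothing-below : NoneBelow P? bot
        nothing-below z<bot pz = <⇒≱ z<bot (leastBelow-lower P? x (below-top pz) pz)
        gap : ∀ {z} → x < z → z < suc h → ¬ P z
        gap x<z z<b pz = noneBelow ¬∃ z<b (x<z , pz)

    prevCyclic-least : ∀ {x y} → P x → NoneBelow P? x → P y → y ≤ prevCyclic x
    prevCyclic-least {x} {y} px none py = begin
      y                                         ≤⟨ greatestBelow-upper P? x (below-top py) py ⟩
      maxOr x                                   ≡⟨ greatestBelow-none P? _ none ⟨
      greatestBelow P? x (maxOr x)              ≡⟨ prevCyclic-member px ⟨
      prevCyclic x                              ∎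
      where open ≤-Reasoning

    nextCyclic-greatest : ∀ {x y} → P x → (∀ {z} → x < z → ¬ P z) → P y → nextCyclic x ≤ y
    nextCyclic-greatest {x} {y} px none py = begin
      nextCyclic x                              ≡⟨ nextCyclic-member px ⟩
      leastBelow (above? x) (suc h) (minOr x)
        ≡⟨ leastBelow-none (above? x) {suc h} _ (λ _ (x<z , pz) → none x<z pz) ⟩
      minOr x                                   ≤⟨ leastBelow-lower P? x (below-top py) py ⟩
      y                                         ∎
      where open ≤-Reasoning

    prevCyclic-monotone : ∀ {a x x′} → P a → a < x → x < x′ → P x ⊎ h < x → P x′ ⊎ h < x′ →
                          prevCyclic x < prevCyclic x′
    prevCyclic-monotone {x = x} {x′} _ _ x<x′ (inj₂ h<x) _ = begin-strict
      prevCyclic x   ≡⟨ prevCyclic-fixes (not-above-h h<x) ⟩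
      x              <⟨ x<x′ ⟩
      x′             ≡⟨ prevCyclic-fixes (not-above-h (<-trans h<x x<x′)) ⟨
      prevCyclic x′  ∎
      where open ≤-Reasoning
    prevCyclic-monotone {x = x} {x′} pa a<x x<x′ (inj₁ px) x′-placed = begin-strict
      prevCyclic x                     ≡⟨ prevCyclic-member px ⟩
      greatestBelow P? x (maxOr x)     <⟨ proj₁ (greatestBelow-member P? _ a<x pa) ⟩
      x                                ≤⟨ x≤prev-x′ x′-placed ⟩
      prevCyclic x′                    ∎
      where
        open ≤-Reasoning
        x≤prev-x′ : P x′ ⊎ h < x′ → x ≤ prevCyclic x′
        x≤prev-x′ (inj₁ px′)  =
          ≤-trans (greatestBelow-upper P? _ x<x′ px) (≤-reflexive (sym (prevCyclic-member px′)))
        x≤prev-x′ (inj₂ h<x′) =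
          ≤-trans (<⇒≤ x<x′) (≤-reflexive (sym (prevCyclic-fixes (not-above-h h<x′))))

    nextCyclic-monotone : ∀ {x x′} → x < x′ → P x ⊎ h < x → P x′ ⊎ h < x′ →
                          (P x′ → ∃ λ b → x′ < b × P b) → nextCyclic x < nextCyclic x′
    nextCyclic-monotone {x} {x′} x<x′ (inj₂ h<x) _ _ = begin-strict
      nextCyclic x   ≡⟨ nextCyclic-fixes (not-above-h h<x) ⟩
      x              <⟨ x<x′ ⟩
      x′             ≡⟨ nextCyclic-fixes (not-above-h (<-trans h<x x<x′)) ⟨
      nextCyclic x′  ∎
      where open ≤-Reasoning
    nextCyclic-monotone {x} {x′} x<x′ (inj₁ px) (inj₂ h<x′) _ = begin-strict
      nextCyclic x   ≤⟨ bounded (nextCyclic-closed px) ⟩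
      h              <⟨ h<x′ ⟩
      x′             ≡⟨ nextCyclic-fixes (not-above-h h<x′) ⟨
      nextCyclic x′  ∎
      where open ≤-Reasoning
    nextCyclic-monotone {x} {x′} x<x′ (inj₁ px) (inj₁ px′) larger = begin-strict
      nextCyclic x                              ≡⟨ nextCyclic-member px ⟩
      leastBelow (above? x) (suc h) (minOr x)   ≤⟨ leastBelow-lower (above? x) _ (below-top px′) (x<x′ , px′) ⟩
      x′                                        <⟨ x′<next ⟩
      leastBelow (above? x′) (suc h) (minOr x′) ≡⟨ nextCyclic-member px′ ⟨
      nextCyclic x′                             ∎
      where
        open ≤-Reasoning
        x′<next : x′ < leastBelow (above? x′) (suc h) (minOr x′)
        x′<next with larger px′
        ... | _ , x′<b , pb =
          proj₁ (proj₂ (leastBelow-member (above? x′) (minOr x′) (below-top pb) (x′<b , pb)))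

module _ {P Q : U.Pred ℕ 0ℓ} (P? : U.Decidable P) (Q? : U.Decidable Q) (P⇔Q : ∀ y → P y ⇔ Q y) where
  open BoundedSearch
  open Equivalence

  greatestBelow-cong : ∀ b d → greatestBelow P? b d ≡ greatestBelow Q? b d
  greatestBelow-cong zero    d = refl
  greatestBelow-cong (suc b) d with P? b | Q? b
  ... | yes _  | yes _  = refl
  ... | no  _  | no  _  = greatestBelow-cong b d
  ... | yes pb | no ¬qb = contradiction (to (P⇔Q b) pb) ¬qb
  ... | no ¬pb | yes qb = contradiction (from (P⇔Q b) qb) ¬pb

  leastBelow-cong : ∀ b d → leastBelow P? b d ≡ leastBelow Q? b d
  leastBelow-cong zero    d = refl
  leastBelow-cong (suc b) d with P? b | Q? b
  ... | yes _  | yes _  = leastBelow-cong b b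
  ... | no  _  | no  _  = leastBelow-cong b d
  ... | yes pb | no ¬qb = contradiction (to (P⇔Q b) pb) ¬qb
  ... | no ¬pb | yes qb = contradiction (from (P⇔Q b) qb) ¬pb

module _ {P Q : U.Pred ℕ 0ℓ} (P? : U.Decidable P) (Q? : U.Decidable Q) (P⇔Q : ∀ y → P y ⇔ Q y) (h : ℕ) where
  open Equivalence

  prevCyclic-cong : ∀ x → Cyclic.prevCyclic P? h x ≡ Cyclic.prevCyclic Q? h x
  prevCyclic-cong x with P? x | Q? x
  ... | yes _  | yes _  =
    trans (greatestBelow-cong P? Q? P⇔Q x _)
          (cong (BoundedSearch.greatestBelow Q? x) (greatestBelow-cong P? Q? P⇔Q (suc h) x))
  ... | no  _  | no  _  = refl
  ... | yes px | no ¬qx = contradiction (to (P⇔Q x) px) ¬qx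
  ... | no ¬px | yes qx = contradiction (from (P⇔Q x) qx) ¬px

  nextCyclic-cong : ∀ x → Cyclic.nextCyclic P? h x ≡ Cyclic.nextCyclic Q? h x
  nextCyclic-cong x with P? x | Q? x
  ... | yes _  | yes _  =
    trans (leastBelow-cong (Cyclic.above? P? h x) (Cyclic.above? Q? h x) above⇔ (suc h) _)
          (cong (BoundedSearch.leastBelow (Cyclic.above? Q? h x) (suc h)) (leastBelow-cong P? Q? P⇔Q (suc h) x))
    where
      above⇔ : ∀ y → (x < y × P y) ⇔ (x < y × Q y)
      above⇔ y = mk⇔ (map₂ (to (P⇔Q y))) (map₂ (from (P⇔Q y)))
  ... | no  _  | no  _  = refl
  ... | yes px | no ¬qx = contradiction (to (P⇔Q x) px) ¬qx
  ... | no ¬px | yes qx = contradiction (from (P⇔Q x) qx) ¬px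

unitColumn : (k : ℕ) → ℕ → Vec Bool k
unitColumn zero    x             = []
unitColumn (suc k) zero          = false ∷ unitColumn k zero
unitColumn (suc k) (suc zero)    = true  ∷ unitColumn k zero
unitColumn (suc k) (suc (suc x)) = false ∷ unitColumn k (suc x)

-- the row of the first 1 (rows start at 1), or one past the end if there is none
firstOne : ∀ {k} → Vec Bool k → ℕ
firstOne []           = 1
firstOne (true  ∷ bs) = 1
firstOne (false ∷ bs) = suc (firstOne bs)

colAt-unitColumn-zero : ∀ k r → colAt (unitColumn k zero) r ≡ false
colAt-unitColumn-zero zero    r             = refl
colAt-unitColumn-zero (suc k) zero          = refl
colAt-unitColumn-zero (suc k) (suc zero)    = refl
colAt-unitColumn-zero (suc k) (suc (suc r)) = colAt-unitColumn-zero k (suc r)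

colAt-unitColumn-true : ∀ k x r → colAt (unitColumn k x) r ≡ true → r ≡ x
colAt-unitColumn-true k zero r e with () ← trans (sym (colAt-unitColumn-zero k r)) e
colAt-unitColumn-true (suc k) (suc zero)    (suc zero)    e = refl
colAt-unitColumn-true (suc k) (suc zero)    (suc (suc r)) e with () ← trans (sym (colAt-unitColumn-zero k (suc r))) e
colAt-unitColumn-true (suc k) (suc (suc x)) (suc (suc r)) e = cong suc (colAt-unitColumn-true k (suc x) (suc r) e)

colAt-unitColumn-self : ∀ {k x} → 1 ≤ x → x ≤ k → colAt (unitColumn k x) x ≡ true
colAt-unitColumn-self {suc k} {suc zero}    _ _       = refl
colAt-unitColumn-self {suc k} {suc (suc x)} _ (s≤s q) = colAt-unitColumn-self {k} {suc x} (s≤s z≤n) q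

firstOne-unitColumn : ∀ {k x} → 1 ≤ x → x ≤ k → firstOne (unitColumn k x) ≡ x
firstOne-unitColumn {suc k} {suc zero}    _ _       = refl
firstOne-unitColumn {suc k} {suc (suc x)} _ (s≤s q) = cong suc (firstOne-unitColumn {k} {suc x} (s≤s z≤n) q)

column-ext : ∀ {k} (c c′ : Vec Bool k) →
             (∀ {r} → 1 ≤ r → r ≤ k → colAt c r ≡ colAt c′ r) → c ≡ c′
column-ext []       []         eq = refl
column-ext (b ∷ bs) (b′ ∷ bs′) eq =
  cong₂ _∷_ (eq (s≤s z≤n) (s≤s z≤n))
            (column-ext bs bs′ λ { {suc r} _ r≤k → eq (s≤s z≤n) (s≤s r≤k) })

unique-one⇒unitColumn : ∀ {k x} (c : Vec Bool k) → colAt c x ≡ true →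
  (∀ {r} → 1 ≤ r → r ≤ k → colAt c r ≡ true → r ≡ x) → c ≡ unitColumn k x
unique-one⇒unitColumn {k} {x} c cx unique = column-ext c (unitColumn k x) pointwise
  where
    pointwise : ∀ {r} → 1 ≤ r → r ≤ k → colAt c r ≡ colAt (unitColumn k x) r
    pointwise {r} 1≤r r≤k with colAt c r in cr | colAt (unitColumn k x) r in ur
    ... | true  | true  = refl
    ... | false | false = refl
    ... | true  | false with refl ← unique 1≤r r≤k cr = trans (sym (colAt-unitColumn-self 1≤r r≤k)) ur
    ... | false | true  with refl ← colAt-unitColumn-true k x r ur = trans (sym cr) cx

column-lookup⁻ : ∀ {m} {hs : Vec ℕ m} (f : ∀ v → Vec Bool (lookup hs v)) v →
                 column (lookup⁻ {xs = hs} f) v ≡ f v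
column-lookup⁻ {hs = _ ∷ _} f Fin.zero    = refl
column-lookup⁻ {hs = _ ∷ hs} f (Fin.suc v) = column-lookup⁻ {hs = hs} (f ∘ Fin.suc) v

labeling-ext : ∀ {m} {hs : Vec ℕ m} (L L′ : All (Vec Bool) hs) →
               (∀ v → column L v ≡ column L′ v) → L ≡ L′
labeling-ext []       []         eq = refl
labeling-ext (c ∷ cs) (c′ ∷ cs′) eq = cong₂ _∷_ (eq Fin.zero) (labeling-ext cs cs′ (eq ∘ Fin.suc))

lookup-ext : ∀ {A : Set} {m} {xs ys : Vec A m} → (∀ i → lookup xs i ≡ lookup ys i) → xs ≡ ys
lookup-ext {xs = xs} {ys} eq = trans (sym (tabulate∘lookup xs)) (trans (tabulate-cong eq) (tabulate∘lookup ys))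

Refinement-cong : ∀ {A : Set} {P Q : A → Set} → (∀ a → P a ⇔ Q a) → Refinement A P ↔ Refinement A Q
Refinement-cong P⇔Q = mk↔ₛ′ (Refinement.refine (Equivalence.to (P⇔Q _)))
                            (Refinement.refine (Equivalence.from (P⇔Q _)))
                            (λ _ → refl) (λ _ → refl)

module Encoding {n : ℕ} {F : Forest n} (Y : ForestYoung F) where
  open Ancestry F

  -- lookup s v : the row of the 1 in column v
  Rows : Set
  Rows = Vec ℕ n

  h : Fin n → ℕ
  h = height Y

  toLabeling : Rows → Labeling Y
  toLabeling s = lookup⁻ {xs = heights Y} λ v → unitColumn (h v) (lookup s v)

  toRows : Labeling Y → Rows
  toRows L = tabulate λ v → firstOne (column L v)

  record IsTransversal (s : Rows) : Set where
    field
      inY       : ∀ v → InY Y (lookup s v) v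
      injective : ∀ {u v} → lookup s u ≡ lookup s v → u ≡ v
      covers    : ∀ r → (∃ λ v → InY Y r v) → ∃ λ v → lookup s v ≡ r

  column-toLabeling : ∀ s v → column (toLabeling s) v ≡ unitColumn (h v) (lookup s v)
  column-toLabeling s = column-lookup⁻ {hs = heights Y} _

  label-toLabeling-true : ∀ s {r v} → label Y (toLabeling s) r v ≡ true → r ≡ lookup s v
  label-toLabeling-true s {r} {v} e =
    colAt-unitColumn-true (h v) (lookup s v) r (trans (cong (λ c → colAt c r) (sym (column-toLabeling s v))) e)

  label-toLabeling-self : ∀ s {v} → InY Y (lookup s v) v → label Y (toLabeling s) (lookup s v) v ≡ true
  label-toLabeling-self s {v} (1≤sv , sv≤h) =
    trans (cong (λ c → colAt c (lookup s v)) (column-toLabeling s v)) (colAt-unitColumn-self 1≤sv sv≤h)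

  label-toLabeling-other : ∀ s {r v} → r ≢ lookup s v → label Y (toLabeling s) r v ≡ false
  label-toLabeling-other s {r} {v} r≢sv with label Y (toLabeling s) r v in e
  ... | true  = contradiction (label-toLabeling-true s e) r≢sv
  ... | false = refl

  isTransversal⇒transversal : ∀ {s} → IsTransversal s → Transversal Y (toLabeling s)
  isTransversal⇒transversal {s} t = one-per-column , one-per-row
    where
      open IsTransversal t
      one-per-column : ∀ v → ExactlyOne λ r → InY Y r v × label Y (toLabeling s) r v ≡ true
      one-per-column v = lookup s v , (inY v , label-toLabeling-self s (inY v)) , λ _ (_ , e) → label-toLabeling-true s e
      one-per-row : ∀ r → (∃ λ v → InY Y r v) →
                    ExactlyOne λ v → InY Y r v × label Y (toLabeling s) r v ≡ true
      one-per-row r nonempty with covers r nonempty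
      ... | v , refl = v , (inY v , label-toLabeling-self s (inY v)) ,
                       λ w (_ , e) → injective (sym (label-toLabeling-true s e))

  transversal⇒isTransversal : ∀ {s} → Transversal Y (toLabeling s) → IsTransversal s
  transversal⇒isTransversal {s} (one-per-column , one-per-row) = record
    { inY = inY ; injective = injective ; covers = covers }
    where
      inY : ∀ v → InY Y (lookup s v) v
      inY v with one-per-column v
      ... | r , (r∈Y , e) , _ = subst (λ r → InY Y r v) (label-toLabeling-true s e) r∈Y
      injective : ∀ {u v} → lookup s u ≡ lookup s v → u ≡ v
      injective {u} {v} su≡sv with one-per-row (lookup s u) (u , inY u)
      ... | _ , _ , unique = trans (unique u (inY u , label-toLabeling-self s (inY u))) (sym (unique v v-hit))
        where
          v-hit : InY Y (lookup s u) v × label Y (toLabeling s) (lookup s u) v ≡ true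
          v-hit rewrite su≡sv = inY v , label-toLabeling-self s (inY v)
      covers : ∀ r → (∃ λ v → InY Y r v) → ∃ λ v → lookup s v ≡ r
      covers r nonempty with one-per-row r nonempty
      ... | v , (_ , e) , _ = v , sym (label-toLabeling-true s e)

  UnitColumns : Labeling Y → Set
  UnitColumns L = ∀ v → column L v ≡ unitColumn (h v) (firstOne (column L v))

  unitColumns? : ∀ L → Dec (UnitColumns L)
  unitColumns? L = all? λ v → ≡-decᵛ _≟ᵇ_ (column L v) (unitColumn (h v) (firstOne (column L v)))

  transversal⇒unitColumns : ∀ {L} → Transversal Y L → UnitColumns L
  transversal⇒unitColumns {L} (one-per-column , _) v with one-per-column v
  ... | r , ((1≤r , r≤h) , e) , unique =
    trans c≡unit (cong (unitColumn (h v)) (sym (trans (cong firstOne c≡unit) (firstOne-unitColumn 1≤r r≤h))))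
    where
      c≡unit : column L v ≡ unitColumn (h v) r
      c≡unit = unique-one⇒unitColumn (column L v) e λ 1≤r′ r′≤h e′ → unique _ ((1≤r′ , r′≤h) , e′)

  toLabeling-toRows : ∀ {L} → UnitColumns L → toLabeling (toRows L) ≡ L
  toLabeling-toRows {L} unit = labeling-ext _ _ λ v → begin
    column (toLabeling (toRows L)) v                ≡⟨ column-toLabeling (toRows L) v ⟩
    unitColumn (h v) (lookup (toRows L) v)          ≡⟨ cong (unitColumn (h v)) (lookup∘tabulate _ v) ⟩
    unitColumn (h v) (firstOne (column L v))        ≡⟨ unit v ⟨
    column L v                                      ∎
    where open ≡-Reasoning

  toRows-toLabeling : ∀ {s} → (∀ v → InY Y (lookup s v) v) → toRows (toLabeling s) ≡ s
  toRows-toLabeling {s} inY = trans (tabulate-cong pointwise) (tabulate∘lookup s)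
    where
      pointwise : ∀ v → firstOne (column (toLabeling s) v) ≡ lookup s v
      pointwise v = trans (cong firstOne (column-toLabeling s v)) (firstOne-unitColumn (proj₁ (inY v)) (proj₂ (inY v)))

  inY? : ∀ s → Dec (∀ v → InY Y (lookup s v) v)
  inY? s = all? λ v → (1 ≤? lookup s v) ×-dec (lookup s v ≤? h v)

  encode : ∀ {k} (M : Fin k → Fin k → Bool) →
           AvoidingTransversals Y M ↔ Refinement Rows λ s → IsTransversal s × Avoids Y M (toLabeling s)
  encode M = mk↔ₛ′ to from to∘from from∘to
    where
      -- the proofs in a Refinement are irrelevant, so the round trips recompute what they need
      rows-of : ∀ {L} → Transversal Y L × Avoids Y M L →
                IsTransversal (toRows L) × Avoids Y M (toLabeling (toRows L))
      rows-of {L} (t , a) =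
        transversal⇒isTransversal (subst (Transversal Y) (sym L≡) t) , subst (Avoids Y M) (sym L≡) a
        where
          L≡ : toLabeling (toRows L) ≡ L
          L≡ = toLabeling-toRows (transversal⇒unitColumns {L} t)
      to : AvoidingTransversals Y M → Refinement Rows λ s → IsTransversal s × Avoids Y M (toLabeling s)
      to (L , [ p ]) = toRows L , [ rows-of {L} p ]
      from : Refinement Rows (λ s → IsTransversal s × Avoids Y M (toLabeling s)) → AvoidingTransversals Y M
      from (s , [ p ]) = toLabeling s , [ isTransversal⇒transversal (proj₁ p) , proj₂ p ]
      to∘from : ∀ x → to (from x) ≡ x
      to∘from (s , [ p ]) = value-injective (toRows-toLabeling (recompute (inY? s) (IsTransversal.inY (proj₁ p))))
      from∘to : ∀ x → from (to x) ≡ x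
      from∘to (L , [ p ]) =
        value-injective (toLabeling-toRows (recompute (unitColumns? L) (transversal⇒unitColumns {L} (proj₁ p))))

  Entry : Labeling Y → ℕ → Fin n → Bool → Set
  Entry L r w b = InY Y r w × label Y L r w ≡ b

  contains₂ : ∀ (M : Fin 2 → Fin 2 → Bool) {L u v r₀ r₁} → Anc F u v → r₀ < r₁ →
              Entry L r₀ u (M 0F 0F) → Entry L r₀ v (M 0F 1F) →
              Entry L r₁ u (M 1F 0F) → Entry L r₁ v (M 1F 1F) → Contains Y M L
  contains₂ M {L} {u} {v} {r₀} {r₁} u<v r₀<r₁ e₀₀ e₀₁ e₁₀ e₁₁ =
    vs , rs , ancestry , increasing , entries
    where
      vs : Fin 2 → Fin n
      vs 0F = u
      vs 1F = v
      rs : Fin 2 → ℕ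
      rs 0F = r₀
      rs 1F = r₁
      ancestry : ∀ i j → Fin.toℕ i < Fin.toℕ j → Anc F (vs i) (vs j)
      ancestry 0F 1F _ = u<v
      ancestry 1F 1F (s≤s ())
      increasing : ∀ i j → Fin.toℕ i < Fin.toℕ j → rs i < rs j
      increasing 0F 1F _ = r₀<r₁
      increasing 1F 1F (s≤s ())
      entries : ∀ i j → Entry L (rs i) (vs j) (M i j)
      entries 0F 0F = e₀₀
      entries 0F 1F = e₀₁
      entries 1F 0F = e₁₀
      entries 1F 1F = e₁₁

  I₂-FreeAt : Rows → Fin n → Set
  I₂-FreeAt s u = ∀ {v} → Anc F u v → lookup s v < lookup s u ⊎ h u < lookup s v

  J₂-FreeAt : Rows → Fin n → Set
  J₂-FreeAt s u = ∀ {v} → Anc F u v → lookup s u < lookup s v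

  inY-descendant : ∀ {r u v} → Anc F u v → InY Y r u → InY Y r v
  inY-descendant u<v (1≤r , r≤hu) = 1≤r , ≤-trans r≤hu (closed Y u<v)

  module _ {s : Rows} (t : IsTransversal s) where
    open IsTransversal t

    rows-distinct : ∀ {u v} → Anc F u v → lookup s u ≢ lookup s v
    rows-distinct u<v su≡sv with refl ← injective su≡sv = anc-irrefl u<v

    own-entry : ∀ v → Entry (toLabeling s) (lookup s v) v true
    own-entry v = inY v , label-toLabeling-self s (inY v)

    avoids-I₂⇔ : Avoids Y I₂ (toLabeling s) ⇔ (∀ u → I₂-FreeAt s u)
    avoids-I₂⇔ = mk⇔ free avoids
      where
        free : Avoids Y I₂ (toLabeling s) → ∀ u → I₂-FreeAt s u
        free avoid u {v} u<v with <-cmp (lookup s v) (lookup s u)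
        ... | tri< sv<su _ _ = inj₁ sv<su
        ... | tri≈ _ sv≡su _ = contradiction (sym sv≡su) (rows-distinct u<v)
        ... | tri> _ _ su<sv with lookup s v ≤? h u
        ...   | no  sv≰hu = inj₂ (≰⇒> sv≰hu)
        ...   | yes sv≤hu = contradiction
          (contains₂ I₂ {toLabeling s} u<v su<sv
            (own-entry u)
            (inY-descendant u<v (inY u) , label-toLabeling-other s (rows-distinct u<v))
            ((proj₁ (inY v) , sv≤hu) , label-toLabeling-other s (rows-distinct u<v ∘ sym))
            (own-entry v))
          avoid
        avoids : (∀ u → I₂-FreeAt s u) → Avoids Y I₂ (toLabeling s)
        avoids free (vs , rs , ancestry , increasing , entries) with free (vs 0F) (ancestry 0F 1F (s≤s z≤n))
        ... | inj₁ sv<su = <-asym sv<su (subst₂ _<_ r₀≡ r₁≡ (increasing 0F 1F (s≤s z≤n)))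
          where
            r₀≡ : rs 0F ≡ lookup s (vs 0F)
            r₀≡ = label-toLabeling-true s (proj₂ (entries 0F 0F))
            r₁≡ : rs 1F ≡ lookup s (vs 1F)
            r₁≡ = label-toLabeling-true s (proj₂ (entries 1F 1F))
        ... | inj₂ hu<sv =
          <⇒≱ hu<sv (subst (_≤ h (vs 0F)) (label-toLabeling-true s (proj₂ (entries 1F 1F))) (proj₂ (proj₁ (entries 1F 0F))))

    avoids-J₂⇔ : Avoids Y J₂ (toLabeling s) ⇔ (∀ u → J₂-FreeAt s u)
    avoids-J₂⇔ = mk⇔ free avoids
      where
        free : Avoids Y J₂ (toLabeling s) → ∀ u → J₂-FreeAt s u
        free avoid u {v} u<v with <-cmp (lookup s u) (lookup s v)
        ... | tri< su<sv _ _ = su<sv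
        ... | tri≈ _ su≡sv _ = contradiction su≡sv (rows-distinct u<v)
        ... | tri> _ _ sv<su = contradiction
          (contains₂ J₂ {toLabeling s} u<v sv<su
            ( (proj₁ (inY v) , ≤-trans (<⇒≤ sv<su) (proj₂ (inY u)))
            , label-toLabeling-other s (rows-distinct u<v ∘ sym))
            (own-entry v)
            (own-entry u)
            (inY-descendant u<v (inY u) , label-toLabeling-other s (rows-distinct u<v)))
          avoid
        avoids : (∀ u → J₂-FreeAt s u) → Avoids Y J₂ (toLabeling s)
        avoids free (vs , rs , ancestry , increasing , entries) =
          <-asym (free (vs 0F) (ancestry 0F 1F (s≤s z≤n))) (subst₂ _<_ r₀≡ r₁≡ (increasing 0F 1F (s≤s z≤n)))
          where
            r₀≡ : rs 0F ≡ lookup s (vs 1F)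
            r₀≡ = label-toLabeling-true s (proj₂ (entries 0F 1F))
            r₁≡ : rs 1F ≡ lookup s (vs 0F)
            r₁≡ = label-toLabeling-true s (proj₂ (entries 1F 0F))

module Rotations {n : ℕ} {F : Forest n} (Y : ForestYoung F) where
  open Ancestry F
  open Encoding Y

  height-monotone : ∀ {u v} → u ≼ v → h u ≤ h v
  height-monotone refl  = ≤-refl
  height-monotone [ a ] = closed Y a

  SubtreeRow : Fin n → Rows → ℕ → Set
  SubtreeRow k s y = y ≤ h k × ∃ λ w → k ≼ w × lookup s w ≡ y

  subtreeRow? : ∀ k s → U.Decidable (SubtreeRow k s)
  subtreeRow? k s y = (y ≤? h k) ×-dec any? λ w → (k ≼? w) ×-dec (lookup s w ≟ y)

  mapSubtreeAt : Fin n → (ℕ → ℕ) → Rows → Fin n → ℕ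
  mapSubtreeAt k f s v = if ⌊ k ≼? v ⌋ then f (lookup s v) else lookup s v

  mapSubtree : Fin n → (ℕ → ℕ) → Rows → Rows
  mapSubtree k f s = tabulate (mapSubtreeAt k f s)

  mapSubtree-inside : ∀ {k f s v} → k ≼ v → lookup (mapSubtree k f s) v ≡ f (lookup s v)
  mapSubtree-inside {k} {f} {s} {v} k≼v rewrite lookup∘tabulate (mapSubtreeAt k f s) v with k ≼? v
  ... | yes _   = refl
  ... | no k⋠v = contradiction k≼v k⋠v

  mapSubtree-outside : ∀ {k f s v} → ¬ k ≼ v → lookup (mapSubtree k f s) v ≡ lookup s v
  mapSubtree-outside {k} {f} {s} {v} k⋠v rewrite lookup∘tabulate (mapSubtreeAt k f s) v with k ≼? v
  ... | yes k≼v = contradiction k≼v k⋠v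
  ... | no _    = refl

  J₂-free-outside : ∀ {k f s u} → ¬ k ≼ u → ¬ Anc F u k → J₂-FreeAt s u → J₂-FreeAt (mapSubtree k f s) u
  J₂-free-outside {k} {f} {s} {u} k⋠u u⊀k free {v} u<v with k ≼? v
  ... | yes k≼v = contradiction (anc-into-subtree k⋠u u<v k≼v) u⊀k
  ... | no  k⋠v =
    subst₂ _<_ (sym (mapSubtree-outside {f = f} {s} k⋠u)) (sym (mapSubtree-outside {f = f} {s} k⋠v)) (free u<v)

  record PermutesSubtreeRows (k : Fin n) (s : Rows) (f g : ℕ → ℕ) : Set where
    field
      fixes             : ∀ {y} → ¬ SubtreeRow k s y → f y ≡ y
      preserves         : ∀ {y} → SubtreeRow k s y → SubtreeRow k s (f y)
      inverse-preserves : ∀ {y} → SubtreeRow k s y → SubtreeRow k s (g y)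
      inverseˡ          : ∀ y → g (f y) ≡ y
      inverseʳ          : ∀ y → f (g y) ≡ y

  module Permuted {k s f g} (π : PermutesSubtreeRows k s f g) where
    open PermutesSubtreeRows π

    t : Rows
    t = mapSubtree k f s

    t-inside : ∀ {v} → k ≼ v → lookup t v ≡ f (lookup s v)
    t-inside = mapSubtree-inside {f = f} {s}

    t-outside : ∀ {v} → ¬ k ≼ v → lookup t v ≡ lookup s v
    t-outside = mapSubtree-outside {f = f} {s}

    t-fixed : ∀ {w} → ¬ SubtreeRow k s (lookup s w) → lookup t w ≡ lookup s w
    t-fixed {w} ¬T with k ≼? w
    ... | yes k≼w = trans (t-inside k≼w) (fixes ¬T)
    ... | no  k⋠w = t-outside k⋠w

    preimage : ∀ {y} → SubtreeRow k s y → ∃ λ v → k ≼ v × lookup t v ≡ y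
    preimage {y} T with inverse-preserves T
    ... | _ , v , k≼v , sv≡gy = v , k≼v , trans (t-inside k≼v) (trans (cong f sv≡gy) (inverseʳ y))

    row-origin : ∀ v → lookup t v ≡ lookup s v ⊎ (k ≼ v × SubtreeRow k s (lookup t v))
    row-origin v with subtreeRow? k s (lookup s v) | k ≼? v
    ... | no ¬T | _       = inj₁ (t-fixed ¬T)
    ... | yes T | yes k≼v = inj₂ (k≼v , subst (SubtreeRow k s) (sym (t-inside k≼v)) (preserves T))
    ... | yes _ | no  k⋠v = inj₁ (t-outside k⋠v)

    subtreeRow-preserved : ∀ y → SubtreeRow k t y ⇔ SubtreeRow k s y
    subtreeRow-preserved y = mk⇔ to from
      where
        to : SubtreeRow k t y → SubtreeRow k s y
        to (y≤hk , w , k≼w , tw≡y) with row-origin w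
        ... | inj₁ tw≡sw     = y≤hk , w , k≼w , trans (sym tw≡sw) tw≡y
        ... | inj₂ (_ , T)   = subst (SubtreeRow k s) tw≡y T
        from : SubtreeRow k s y → SubtreeRow k t y
        from T@(y≤hk , _) = y≤hk , preimage T

    isTransversal-preserved : IsTransversal s → IsTransversal t
    isTransversal-preserved tr = record { inY = inY′ ; injective = injective′ ; covers = covers′ }
      where
        open IsTransversal tr
        inY′ : ∀ v → InY Y (lookup t v) v
        inY′ v with row-origin v
        ... | inj₁ tv≡sv = subst (λ r → InY Y r v) (sym tv≡sv) (inY v)
        ... | inj₂ (k≼v , tv≤hk , w , _ , sw≡tv) =
          subst (1 ≤_) sw≡tv (proj₁ (inY w)) , ≤-trans tv≤hk (height-monotone k≼v)

        injective-across : ∀ {u v} → k ≼ u → ¬ k ≼ v → lookup t u ≡ lookup t v → u ≡ v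
        injective-across {u} {v} k≼u k⋠v tu≡tv with subtreeRow? k s (lookup s u)
        ... | no ¬T = injective (trans (sym (t-fixed ¬T)) (trans tu≡tv (t-outside k⋠v)))
        ... | yes T with preserves T
        ...   | _ , w , k≼w , sw≡fsu
          with refl ← injective (trans sw≡fsu (trans (sym (t-inside k≼u)) (trans tu≡tv (t-outside k⋠v)))) =
          contradiction k≼w k⋠v

        injective′ : ∀ {u v} → lookup t u ≡ lookup t v → u ≡ v
        injective′ {u} {v} tu≡tv with k ≼? u | k ≼? v
        ... | yes k≼u | yes k≼v = injective (begin
          lookup s u          ≡⟨ inverseˡ _ ⟨
          g (f (lookup s u))  ≡⟨ cong g (trans (sym (t-inside k≼u)) (trans tu≡tv (t-inside k≼v))) ⟩
          g (f (lookup s v))  ≡⟨ inverseˡ _ ⟩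
          lookup s v          ∎)
          where open ≡-Reasoning
        ... | no  k⋠u | no  k⋠v = injective (trans (sym (t-outside k⋠u)) (trans tu≡tv (t-outside k⋠v)))
        ... | yes k≼u | no  k⋠v = injective-across k≼u k⋠v tu≡tv
        ... | no  k⋠u | yes k≼v = sym (injective-across k≼v k⋠u (sym tu≡tv))

        covers′ : ∀ r → (∃ λ v → InY Y r v) → ∃ λ v → lookup t v ≡ r
        covers′ r nonempty with covers r nonempty
        ... | w , refl with subtreeRow? k s (lookup s w)
        ...   | yes T = let v , _ , tv≡sw = preimage T in v , tv≡sw
        ...   | no ¬T = w , t-fixed ¬T

    mapSubtree-inverse : ∀ {g′} → (∀ y → g′ y ≡ g y) → mapSubtree k g′ t ≡ s
    mapSubtree-inverse {g′} g′≗g = lookup-ext pointwise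
      where
        pointwise : ∀ v → lookup (mapSubtree k g′ t) v ≡ lookup s v
        pointwise v with k ≼? v
        ... | no k⋠v  = trans (mapSubtree-outside {f = g′} {t} k⋠v) (t-outside k⋠v)
        ... | yes k≼v = begin
          lookup (mapSubtree k g′ t) v  ≡⟨ mapSubtree-inside {f = g′} {t} k≼v ⟩
          g′ (lookup t v)               ≡⟨ g′≗g (lookup t v) ⟩
          g (lookup t v)                ≡⟨ cong g (t-inside k≼v) ⟩
          g (f (lookup s v))            ≡⟨ inverseˡ (lookup s v) ⟩
          lookup s v                    ∎
          where open ≡-Reasoning

    I₂-free-outside : ∀ {u} → ¬ k ≼ u → I₂-FreeAt s u → I₂-FreeAt t u
    I₂-free-outside {u} k⋠u free {v} u<v rewrite t-outside k⋠u with row-origin v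
    ... | inj₁ tv≡sv rewrite tv≡sv = free u<v
    ... | inj₂ (k≼v , _ , w , k≼w , sw≡tv) =
      subst (λ r → r < lookup s u ⊎ h u < r) sw≡tv (free (anc-≼-trans (anc-into-subtree k⋠u u<v k≼v) k≼w))

  rotateDown : Fin n → Rows → Rows
  rotateDown k s = mapSubtree k (Cyclic.prevCyclic (subtreeRow? k s) (h k)) s

  rotateUp : Fin n → Rows → Rows
  rotateUp k s = mapSubtree k (Cyclic.nextCyclic (subtreeRow? k s) (h k)) s

  module _ (k : Fin n) (s : Rows) where
    open Cyclic (subtreeRow? k s) (h k)

    rotateDown-permutes : PermutesSubtreeRows k s prevCyclic nextCyclic
    rotateDown-permutes = record
      { fixes             = prevCyclic-fixes
      ; preserves         = prevCyclic-closed proj₁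
      ; inverse-preserves = nextCyclic-closed proj₁
      ; inverseˡ          = nextCyclic-prevCyclic proj₁
      ; inverseʳ          = prevCyclic-nextCyclic proj₁
      }

    rotateUp-permutes : PermutesSubtreeRows k s nextCyclic prevCyclic
    rotateUp-permutes = record
      { fixes             = nextCyclic-fixes
      ; preserves         = nextCyclic-closed proj₁
      ; inverse-preserves = prevCyclic-closed proj₁
      ; inverseˡ          = prevCyclic-nextCyclic proj₁
      ; inverseʳ          = nextCyclic-prevCyclic proj₁
      }

  rotateUp-rotateDown : ∀ k s → rotateUp k (rotateDown k s) ≡ s
  rotateUp-rotateDown k s = mapSubtree-inverse λ y →
    nextCyclic-cong (subtreeRow? k t) (subtreeRow? k s) subtreeRow-preserved (h k) y
    where open Permuted (rotateDown-permutes k s)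

  rotateDown-rotateUp : ∀ k s → rotateDown k (rotateUp k s) ≡ s
  rotateDown-rotateUp k s = mapSubtree-inverse λ y →
    prevCyclic-cong (subtreeRow? k t) (subtreeRow? k s) subtreeRow-preserved (h k) y
    where open Permuted (rotateUp-permutes k s)

  record Stage (c : ℕ) (s : Rows) : Set where
    field
      transversal   : IsTransversal s
      I₂-free-below : ∀ u → toℕ u < c → I₂-FreeAt s u
      J₂-free-from  : ∀ u → c ≤ toℕ u → J₂-FreeAt s u

  module _ (k : Fin n) {s : Rows} where
    open Cyclic (subtreeRow? k s) (h k)

    private
      row-of-k : IsTransversal s → SubtreeRow k s (lookup s k)
      row-of-k tr = proj₂ (IsTransversal.inY tr k) , k , refl , refl

      placed : ∀ {w} → k ≼ w → SubtreeRow k s (lookup s w) ⊎ h k < lookup s w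
      placed {w} k≼w with lookup s w ≤? h k
      ... | yes sw≤hk = inj₁ (sw≤hk , w , k≼w , refl)
      ... | no  sw≰hk = inj₂ (≰⇒> sw≰hk)

    rotateDown-stage : Stage (toℕ k) s → Stage (suc (toℕ k)) (rotateDown k s)
    rotateDown-stage stage = record
      { transversal   = t-transversal
      ; I₂-free-below = I₂-free-upto
      ; J₂-free-from  = J₂-free-after
      }
      where
        open Stage stage
        open Permuted (rotateDown-permutes k s)

        t-transversal : IsTransversal t
        t-transversal = isTransversal-preserved transversal

        k-least : BoundedSearch.NoneBelow (subtreeRow? k s) (lookup s k)
        k-least z<sk (_ , .k , refl , sk≡z) = <-irrefl (sym sk≡z) z<sk
        k-least z<sk (_ , w , [ k⊏w ] , sw≡z) =
          <-asym z<sk (subst (lookup s k <_) sw≡z (J₂-free-from k ≤-refl k⊏w))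

        I₂-free-at-k : I₂-FreeAt t k
        I₂-free-at-k {v} k⊏v with lookup t v ≤? h k
        ... | no  tv≰hk = inj₂ (≰⇒> tv≰hk)
        ... | yes tv≤hk = inj₁ (≤∧≢⇒< tv≤tk (rows-distinct t-transversal k⊏v ∘ sym))
          where
            tv≤tk : lookup t v ≤ lookup t k
            tv≤tk = subst (lookup t v ≤_) (sym (t-inside refl))
              (prevCyclic-least proj₁ (row-of-k transversal) k-least
                (Equivalence.to (subtreeRow-preserved _) (tv≤hk , v , [ k⊏v ] , refl)))

        I₂-free-upto : ∀ u → toℕ u < suc (toℕ k) → I₂-FreeAt t u
        I₂-free-upto u u≤k with m≤n⇒m<n∨m≡n (≤-pred u≤k)
        ... | inj₁ u<k = I₂-free-outside (λ k≼u → <⇒≱ u<k (≼⇒≤ k≼u)) (I₂-free-below u u<k)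
        ... | inj₂ u≡k with refl ← toℕ-injective u≡k = I₂-free-at-k

        J₂-free-after : ∀ u → suc (toℕ k) ≤ toℕ u → J₂-FreeAt t u
        J₂-free-after u k<u with k ≼? u
        ... | yes refl = contradiction k<u (<-irrefl refl)
        ... | yes [ k⊏u ] = λ u⊏v →
          subst₂ _<_ (sym (t-inside [ k⊏u ])) (sym (t-inside [ anc-trans k⊏u u⊏v ]))
            (prevCyclic-monotone proj₁ (row-of-k transversal) (J₂-free-from k ≤-refl k⊏u)
              (J₂-free-from u (<⇒≤ k<u) u⊏v) (placed [ k⊏u ]) (placed [ anc-trans k⊏u u⊏v ]))
        ... | no k⋠u =
          J₂-free-outside {f = prevCyclic} {s} k⋠u (λ u⊏k → <-asym k<u (anc⇒< u⊏k)) (J₂-free-from u (<⇒≤ k<u))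

    rotateUp-stage : Stage (suc (toℕ k)) s → Stage (toℕ k) (rotateUp k s)
    rotateUp-stage stage = record
      { transversal   = t-transversal
      ; I₂-free-below = I₂-free-before
      ; J₂-free-from  = J₂-free-from-k
      }
      where
        open Stage stage
        open Permuted (rotateUp-permutes k s)

        t-transversal : IsTransversal t
        t-transversal = isTransversal-preserved transversal

        k-greatest : ∀ {z} → lookup s k < z → ¬ SubtreeRow k s z
        k-greatest sk<z (_ , .k , refl , sk≡z) = <-irrefl sk≡z sk<z
        k-greatest sk<z (z≤hk , w , [ k⊏w ] , sw≡z) with I₂-free-below k ≤-refl k⊏w
        ... | inj₁ sw<sk = <-asym sk<z (subst (_< lookup s k) sw≡z sw<sk)
        ... | inj₂ hk<sw = <⇒≱ hk<sw (subst (_≤ h k) (sym sw≡z) z≤hk)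

        larger-row : ∀ {v} → Anc F k v → SubtreeRow k s (lookup s v) →
                     ∃ λ b → lookup s v < b × SubtreeRow k s b
        larger-row k⊏v (sv≤hk , _) with I₂-free-below k ≤-refl k⊏v
        ... | inj₁ sv<sk = lookup s k , sv<sk , row-of-k transversal
        ... | inj₂ hk<sv = contradiction sv≤hk (<⇒≱ hk<sv)

        J₂-free-at-k : J₂-FreeAt t k
        J₂-free-at-k {v} k⊏v with lookup t v ≤? h k
        ... | no  tv≰hk = ≤-<-trans tk≤hk (≰⇒> tv≰hk)
          where
            tk≤hk : lookup t k ≤ h k
            tk≤hk = subst (_≤ h k) (sym (t-inside refl)) (proj₁ (nextCyclic-closed proj₁ (row-of-k transversal)))
        ... | yes tv≤hk = ≤∧≢⇒< tk≤tv (rows-distinct t-transversal k⊏v)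
          where
            tk≤tv : lookup t k ≤ lookup t v
            tk≤tv = subst (_≤ lookup t v) (sym (t-inside refl))
              (nextCyclic-greatest proj₁ (row-of-k transversal) k-greatest
                (Equivalence.to (subtreeRow-preserved _) (tv≤hk , v , [ k⊏v ] , refl)))

        I₂-free-before : ∀ u → toℕ u < toℕ k → I₂-FreeAt t u
        I₂-free-before u u<k =
          I₂-free-outside (λ k≼u → <⇒≱ u<k (≼⇒≤ k≼u)) (I₂-free-below u (m≤n⇒m≤1+n u<k))

        J₂-free-from-k : ∀ u → toℕ k ≤ toℕ u → J₂-FreeAt t u
        J₂-free-from-k u k≤u with m≤n⇒m<n∨m≡n k≤u
        ... | inj₂ k≡u with refl ← toℕ-injective k≡u = J₂-free-at-k
        ... | inj₁ k<u with k ≼? u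
        ...   | yes refl    = contradiction k<u (<-irrefl refl)
        ...   | yes [ k⊏u ] = λ u⊏v →
          subst₂ _<_ (sym (t-inside [ k⊏u ])) (sym (t-inside [ anc-trans k⊏u u⊏v ]))
            (nextCyclic-monotone proj₁ (J₂-free-from u k<u u⊏v) (placed [ k⊏u ]) (placed [ anc-trans k⊏u u⊏v ])
              (larger-row (anc-trans k⊏u u⊏v)))
        ...   | no  k⋠u     =
          J₂-free-outside {f = nextCyclic} {s} k⋠u (λ u⊏k → <-asym k<u (anc⇒< u⊏k)) (J₂-free-from u k<u)

module Iteration {n : ℕ} {F : Forest n} (Y : ForestYoung F) where
  open Encoding Y
  open Rotations Y

  forward : (c : ℕ) → c ≤ n → Rows → Rows
  forward zero    _   s = s
  forward (suc c) c<n s = rotateDown (fromℕ< c<n) (forward c (<⇒≤ c<n) s)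

  backward : (c : ℕ) → c ≤ n → Rows → Rows
  backward zero    _   s = s
  backward (suc c) c<n s = backward c (<⇒≤ c<n) (rotateUp (fromℕ< c<n) s)

  backward-forward : ∀ c (c≤n : c ≤ n) s → backward c c≤n (forward c c≤n s) ≡ s
  backward-forward zero    _   s = refl
  backward-forward (suc c) c<n s =
    trans (cong (backward c (<⇒≤ c<n)) (rotateUp-rotateDown (fromℕ< c<n) (forward c (<⇒≤ c<n) s)))
          (backward-forward c (<⇒≤ c<n) s)

  forward-backward : ∀ c (c≤n : c ≤ n) s → forward c c≤n (backward c c≤n s) ≡ s
  forward-backward zero    _   s = refl
  forward-backward (suc c) c<n s =
    trans (cong (rotateDown (fromℕ< c<n)) (forward-backward c (<⇒≤ c<n) (rotateUp (fromℕ< c<n) s)))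
          (rotateDown-rotateUp (fromℕ< c<n) s)

  forward-stage : ∀ c (c≤n : c ≤ n) {s} → Stage 0 s → Stage c (forward c c≤n s)
  forward-stage zero    _   st = st
  forward-stage (suc c) c<n {s} st =
    subst (λ i → Stage (suc i) (forward (suc c) c<n s)) (toℕ-fromℕ< c<n)
      (rotateDown-stage (fromℕ< c<n)
        (subst (λ i → Stage i s′) (sym (toℕ-fromℕ< c<n)) (forward-stage c (<⇒≤ c<n) st)))
    where
      s′ : Rows
      s′ = forward c (<⇒≤ c<n) s

  backward-stage : ∀ c (c≤n : c ≤ n) {s} → Stage c s → Stage 0 (backward c c≤n s)
  backward-stage zero    _   st = st
  backward-stage (suc c) c<n {s} st =
    backward-stage c (<⇒≤ c<n) (subst (λ i → Stage i (rotateUp (fromℕ< c<n) s)) (toℕ-fromℕ< c<n)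
      (rotateUp-stage (fromℕ< c<n) (subst (λ i → Stage (suc i) s) (sym (toℕ-fromℕ< c<n)) st)))

  first↔last : Refinement Rows (Stage 0) ↔ Refinement Rows (Stage n)
  first↔last = mk↔ₛ′
    (λ (s , [ st ]) → forward n ≤-refl s , [ forward-stage n ≤-refl st ])
    (λ (s , [ st ]) → backward n ≤-refl s , [ backward-stage n ≤-refl st ])
    (λ (s , _) → value-injective (forward-backward n ≤-refl s))
    (λ (s , _) → value-injective (backward-forward n ≤-refl s))

  avoids-J₂⇔stage₀ : ∀ s → (IsTransversal s × Avoids Y J₂ (toLabeling s)) ⇔ Stage 0 s
  avoids-J₂⇔stage₀ s = mk⇔
    (λ (tr , avoid) → record
      { transversal   = tr
      ; I₂-free-below = λ _ ()
      ; J₂-free-from  = λ u _ → Equivalence.to (avoids-J₂⇔ tr) avoid u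
      })
    (λ st → let open Stage st in
      transversal , Equivalence.from (avoids-J₂⇔ transversal) λ u → J₂-free-from u z≤n)

  avoids-I₂⇔stageₙ : ∀ s → (IsTransversal s × Avoids Y I₂ (toLabeling s)) ⇔ Stage n s
  avoids-I₂⇔stageₙ s = mk⇔
    (λ (tr , avoid) → record
      { transversal   = tr
      ; I₂-free-below = λ u _ → Equivalence.to (avoids-I₂⇔ tr) avoid u
      ; J₂-free-from  = λ u n≤u → contradiction (<-≤-trans (toℕ<n u) n≤u) (<-irrefl refl)
      })
    (λ st → let open Stage st in
      transversal , Equivalence.from (avoids-I₂⇔ transversal) λ u → I₂-free-below u (toℕ<n u))

proposition5p9 : ∀ {n : ℕ} (F : Forest n) (Y : ForestYoung F) →
    AvoidingTransversals Y I₂ ↔ AvoidingTransversals Y J₂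
proposition5p9 {n} F Y = begin
  AvoidingTransversals Y I₂                                             ↔⟨ encode I₂ ⟩
  Refinement Rows (λ s → IsTransversal s × Avoids Y I₂ (toLabeling s))  ↔⟨ Refinement-cong avoids-I₂⇔stageₙ ⟩
  Refinement Rows (Stage n)                                             ↔⟨ first↔last ⟨
  Refinement Rows (Stage 0)                                             ↔⟨ Refinement-cong avoids-J₂⇔stage₀ ⟨
  Refinement Rows (λ s → IsTransversal s × Avoids Y J₂ (toLabeling s))  ↔⟨ encode J₂ ⟨
  AvoidingTransversals Y J₂                                             ∎
  where
    open Encoding Y
    open Rotations Y
    open Iteration Y
    open EquationalReasoning {k = bijection}
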